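{- Let $G$ be a $1$-minor-balanced graph. Then (a) $G$ is connected; (b) if $G$ is strictly $1$-minor-balanced, then either $G$ is $K_2$ or $G$ is $2$-connected; and (c) $G$ is strictly minor-balanced.
   Context: All graphs are finite and simple. The $1$-density is $\rho_1(G)=e(G)/(v(G)-1)$ if $e(G)>0$ and $\rho_1(G)=0$ otherwise. $G$ is $1$-minor-balanced if $\rho_1(G)>0$ and $\rho_1(G)\ge\rho_1(H)$ for every minor $H$ of $G$; strictly $1$-minor-balanced if $\rho_1(G)>0$ and $\rho_1(G)>\rho_1(H)$ for every proper minor $H$ of $G$. $G$ is strictly minor-balanced if every proper minor $H$ of $G$ satisfies $e(H)/v(H)<e(G)/v(G)$. -}

module Defs where

open import Data.Nat using (ℕ; zero; suc; _∸_; _<ᵇ_) renaming (_<_ to _<ℕ_)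
open import Data.Fin using (Fin; toℕ)
open import Data.List using (List; map; allFin)
open import Data.Nat.ListAction using (sum)
open import Data.Bool using (Bool; true; false; if_then_else_; _∧_)
open import Data.Maybe using (Maybe; just)
open import Data.Product using (Σ; _×_; ∃; _,_)
open import Data.Unit using (⊤)
open import Data.Integer using (+_)
open import Data.Rational using (ℚ; _/_; _<_; _≤_; 0ℚ)
open import Relation.Nullary using (¬_)
open import Relation.Binary.PropositionalEquality using (_≡_)
open import Function.Bundles using (_↔_; Inverse)

record Graph : Set where
  field
    V          : ℕ
    adj        : Fin V → Fin V → Bool
    adj-sym    : ∀ i j → adj i j ≡ adj j i
    adj-irrefl : ∀ i → adj i i ≡ false
open Graph public

Adj : (G : Graph) → Fin (V G) → Fin (V G) → Set
Adj G i j = adj G i j ≡ true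

v : Graph → ℕ
v G = V G

e : Graph → ℕ
e G = sum (map (λ i → sum (map (λ j →
        if adj G i j ∧ (toℕ i <ᵇ toℕ j) then 1 else 0) (allFin (V G)))) (allFin (V G)))

-- 1-density  ρ₁(G) = e(G)/(v(G)-1) if e(G) > 0, and 0 otherwise.
-- (when e(G) > 0 a simple graph has v(G) ≥ 2; the remaining cases are unreachable junk)
ρ₁-aux : ℕ → ℕ → ℚ
ρ₁-aux zero    _             = 0ℚ
ρ₁-aux (suc m) zero          = 0ℚ
ρ₁-aux (suc m) (suc zero)    = 0ℚ
ρ₁-aux (suc m) (suc (suc k)) = (+ suc m) / suc k

ρ₁ : Graph → ℚ
ρ₁ G = ρ₁-aux (e G) (v G)

-- ordinary density e(G)/v(G) (junk value 0 for the null graph)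
dens-aux : ℕ → ℕ → ℚ
dens-aux m zero    = 0ℚ
dens-aux m (suc k) = (+ m) / suc k

dens : Graph → ℚ
dens G = dens-aux (e G) (v G)

data Walk (G : Graph) (P : Fin (V G) → Set) : Fin (V G) → Fin (V G) → Set where
  stop : ∀ {u} → P u → Walk G P u u
  step : ∀ {u w x} → P u → Adj G u w → Walk G P w x → Walk G P u x

ConnectedIn : (G : Graph) → (Fin (V G) → Set) → Set
ConnectedIn G P = ∀ u w → P u → P w → Walk G P u w

Connected : Graph → Set
Connected G = ConnectedIn G (λ _ → ⊤)

TwoConnected : Graph → Set
TwoConnected G = (2 <ℕ V G) × Connected G × (∀ x → ConnectedIn G (λ u → ¬ u ≡ x))

_≅_ : Graph → Graph → Set
G ≅ H = Σ (Fin (V G) ↔ Fin (V H)) λ φ →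
          ∀ i j → adj G i j ≡ adj H (Inverse.to φ i) (Inverse.to φ j)

-- H is a minor of G: there are disjoint nonempty connected branch sets
-- β⁻¹(just h) ⊆ V(G), one for each h ∈ V(H), such that adjacent vertices of H
-- have adjacent branch sets.
_≼_ : Graph → Graph → Set
H ≼ G = Σ (Fin (V G) → Maybe (Fin (V H))) λ β →
          (∀ h → ∃ λ u → β u ≡ just h)
        × (∀ h → ConnectedIn G (λ u → β u ≡ just h))
        × (∀ h h' → Adj H h h' →
             Σ (Fin (V G)) λ u → Σ (Fin (V G)) λ u' →
               β u ≡ just h × β u' ≡ just h' × Adj G u u')

_≺_ : Graph → Graph → Set
H ≺ G = (H ≼ G) × ¬ (H ≅ G)

OneMinorBalanced : Graph → Set
OneMinorBalanced G = (0ℚ < ρ₁ G) × (∀ H → H ≼ G → ρ₁ H ≤ ρ₁ G)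

StrictlyOneMinorBalanced : Graph → Set
StrictlyOneMinorBalanced G = (0ℚ < ρ₁ G) × (∀ H → H ≺ G → ρ₁ H < ρ₁ G)

-- proper minors with at least one vertex (e/v is undefined on the null graph)
StrictlyMinorBalanced : Graph → Set
StrictlyMinorBalanced G = ∀ H → H ≺ G → 0 <ℕ V H → dens H < dens G

K₂ : Graph
K₂ = record { V = 2 ; adj = a ; adj-sym = s ; adj-irrefl = r }
  where
    a : Fin 2 → Fin 2 → Bool
    a Fin.zero Fin.zero = false
    a Fin.zero (Fin.suc Fin.zero) = true
    a (Fin.suc Fin.zero) Fin.zero = true
    a (Fin.suc Fin.zero) (Fin.suc Fin.zero) = false
    s : ∀ i j → a i j ≡ a j i
    s Fin.zero Fin.zero = _≡_.refl
    s Fin.zero (Fin.suc Fin.zero) = _≡_.refl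
    s (Fin.suc Fin.zero) Fin.zero = _≡_.refl
    s (Fin.suc Fin.zero) (Fin.suc Fin.zero) = _≡_.refl
    r : ∀ i → a i i ≡ false
    r Fin.zero = _≡_.refl
    r (Fin.suc Fin.zero) = _≡_.refl

module Submission where

-- If G is 1-minor-balanced, every induced subgraph G[X] satisfies
-- e(G[X]) (v(G) − 1) ≤ e(G) (|X| − 1).  Let (A, B) be a separation of G
-- (A ∪ B = V(G), no edge between A ∖ B and B ∖ A) whose overlap A ∩ B has
-- k ≤ 1 vertices.  Then every edge lies inside exactly one side, so
-- e(G) = e(G[A]) + e(G[B]) while |A| + |B| = v(G) + k, and adding the two
-- balance inequalities gives e(G) (v(G) − 1) ≤ e(G) (v(G) + k − 2).  This is
-- impossible for k = 0, which yields connectivity; if G is strictly balanced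
-- and both sides are proper, the inequalities are strict and k = 1 is
-- impossible too, which yields 2-connectivity unless v(G) = 2.  For (c), a
-- proper minor H has e(H) < e(G): from the balance inequality if
-- v(H) < v(G), and because H is then a spanning subgraph of G otherwise; so
-- e(H) v(G) = e(H) (v(G) − 1) + e(H) < e(G) (v(H) − 1) + e(G) = e(G) v(H).

open import Defs
open import Data.Nat as ℕ using (ℕ; zero; suc; _+_; _*_; _∸_; _≤_; _<_; z≤n; s≤s; _<ᵇ_)
open import Data.Nat.Properties as ℕₚ using (+-0-commutativeMonoid)
import Data.Nat.ListAction as List
open import Data.Fin using (Fin; zero; suc; toℕ; punchOut)
import Data.Fin.Properties as Finₚ
open import Data.Bool using (Bool; true; false; _∧_; _∨_; not; if_then_else_)
open import Data.Bool.Properties as Boolₚ using (∧-zeroʳ; ∧-identityʳ)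
open import Data.List using (map; allFin; tabulate)
open import Data.Maybe using (Maybe; just; nothing)
import Data.Maybe.Properties as Maybeₚ
open import Data.Product using (_×_; _,_; ∃; proj₁; proj₂)
open import Data.Sum using (_⊎_; inj₁; inj₂; [_,_]′)
open import Data.Empty using (⊥; ⊥-elim)
open import Data.Unit using (tt)
import Data.Integer as ℤ
import Data.Integer.Properties as ℤₚ
open import Data.Rational as ℚ using (_/_; 0ℚ; toℚᵘ)
import Data.Rational.Properties as ℚₚ
open import Data.Rational.Unnormalised as ℚᵘ using (mkℚᵘ; *<*; *≤*)
import Data.Rational.Unnormalised.Properties as ℚᵘₚ
open import Relation.Binary.PropositionalEquality
  using (_≡_; _≢_; refl; sym; trans; cong; cong₂; subst; subst₂; module ≡-Reasoning)
open import Relation.Nullary using (Dec; yes; no; ¬_; does; contradiction)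
open import Relation.Nullary.Decidable using (dec-true; dec-false; _×-dec_; ¬?; decidable-stable)
open import Relation.Unary using (Decidable)
open import Relation.Unary.Properties using (U?; ∁?)
open import Function using (_∘_)
open import Function.Bundles using (Injection; Inverse; _↔_; mk↔ₛ′)
open import Function.Construct.Identity using (↔-id)
open import Function.Definitions using (Injective)
open import Function.Properties.Inverse using (↔⇒↣; ↔-sym)
open import Algebra.Properties.CommutativeMonoid.Sum +-0-commutativeMonoid
  using (sum; sum-syntax; sum-cong-≗; sum-replicate-zero; ∑-distrib-+; ∑-comm; sum-permute)

-- Finite sums and counting

[_] : Bool → ℕ
[ true ]  = 1
[ false ] = 0

if-1-0≡[] : ∀ b → (if b then 1 else 0) ≡ [ b ]
if-1-0≡[] true  = refl
if-1-0≡[] false = refl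

if-[] : ∀ x y → (if x then [ y ] else 0) ≡ [ x ∧ y ]
if-[] true  y = refl
if-[] false y = refl

[]-split : ∀ x b → [ x ] ≡ [ x ∧ b ] + [ x ∧ not b ]
[]-split false b     = refl
[]-split true  true  = refl
[]-split true  false = refl

[]-∨-∧ : ∀ x y → [ x ] + [ y ] ≡ [ x ∨ y ] + [ x ∧ y ]
[]-∨-∧ true  y     = refl
[]-∨-∧ false true  = refl
[]-∨-∧ false false = refl

[]-mono : ∀ {x y} → (x ≡ true → y ≡ true) → [ x ] ≤ [ y ]
[]-mono {false} x⇒y = z≤n
[]-mono {true}  x⇒y rewrite x⇒y refl = s≤s z≤n

[]-injective : ∀ {x y} → [ x ] ≡ [ y ] → x ≡ y
[]-injective {false} {false} _ = refl
[]-injective {true}  {true}  _ = refl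

sum-tabulate : ∀ {A : Set} {n} (f : A → ℕ) (g : Fin n → A) → List.sum (map f (tabulate g)) ≡ sum (f ∘ g)
sum-tabulate {n = zero}  f g = refl
sum-tabulate {n = suc n} f g = cong (f (g zero) +_) (sum-tabulate f (g ∘ suc))

sum-allFin : ∀ {n} (f : Fin n → ℕ) → List.sum (map f (allFin n)) ≡ sum f
sum-allFin f = sum-tabulate f (λ i → i)

sum-if : ∀ {n} b (f : Fin n → ℕ) → (if b then sum f else 0) ≡ ∑[ i < n ] (if b then f i else 0)
sum-if     true  f = refl
sum-if {n} false f = sym (sum-replicate-zero n)

sum-mono-≤ : ∀ {n} {f g : Fin n → ℕ} → (∀ i → f i ≤ g i) → sum f ≤ sum g
sum-mono-≤ {zero}  f≤g = z≤n
sum-mono-≤ {suc n} f≤g = ℕₚ.+-mono-≤ (f≤g zero) (sum-mono-≤ (f≤g ∘ suc))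

sum-≡-≤⇒≗ : ∀ {n} {f g : Fin n → ℕ} → (∀ i → f i ≤ g i) → sum f ≡ sum g → ∀ i → f i ≡ g i
sum-≡-≤⇒≗ {suc n} {f} {g} f≤g Σf≡Σg = pointwise
  where
  head≡ : f zero ≡ g zero
  head≡ = ℕₚ.≤-antisym (f≤g zero) (ℕₚ.+-cancelʳ-≤ (sum (f ∘ suc)) (g zero) (f zero)
            (ℕₚ.≤-trans (ℕₚ.+-monoʳ-≤ (g zero) (sum-mono-≤ (f≤g ∘ suc))) (ℕₚ.≤-reflexive (sym Σf≡Σg))))
  pointwise : ∀ i → f i ≡ g i
  pointwise zero    = head≡
  pointwise (suc i) = sum-≡-≤⇒≗ (f≤g ∘ suc)
    (ℕₚ.+-cancelˡ-≡ (f zero) _ _ (trans Σf≡Σg (cong (_+ sum (g ∘ suc)) (sym head≡)))) i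

count : ∀ {n} → (Fin n → Bool) → ℕ
count {n} p = ∑[ a < n ] [ p a ]

count-all : ∀ {n} {p : Fin n → Bool} → (∀ a → p a ≡ true) → count p ≡ n
count-all {zero}  all = refl
count-all {suc n} all rewrite all zero = cong suc (count-all (all ∘ suc))

count-none : ∀ {n} {p : Fin n → Bool} → (∀ a → p a ≡ false) → count p ≡ 0
count-none {n} none = trans (sum-cong-≗ (λ a → cong [_] (none a))) (sum-replicate-zero n)

count-remove : ∀ {n} (p : Fin n → Bool) u → p u ≡ true →
               count p ≡ suc (count (λ a → p a ∧ not (does (a Finₚ.≟ u))))
count-remove {suc n} p zero    pu rewrite pu =
  cong suc (sum-cong-≗ λ a → cong [_] (sym (∧-identityʳ (p (suc a)))))
count-remove {suc n} p (suc u) pu rewrite ∧-identityʳ (p zero) | count-remove (p ∘ suc) u pu =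
  ℕₚ.+-suc [ p zero ] _

1≤count : ∀ {n} {p : Fin n → Bool} {a} → p a ≡ true → 1 ≤ count p
1≤count {p = p} {a} pa = subst (1 ≤_) (sym (count-remove p a pa)) (s≤s z≤n)

2≤count : ∀ {n} {p : Fin n → Bool} {a b} → p a ≡ true → p b ≡ true → a ≢ b → 2 ≤ count p
2≤count {p = p} {a} {b} pa pb a≢b =
  subst (2 ≤_) (sym (count-remove p a pa)) (s≤s (1≤count {a = b} pb-without-a))
  where
  pb-without-a : (p b ∧ not (does (b Finₚ.≟ a))) ≡ true
  pb-without-a rewrite pb | dec-false (b Finₚ.≟ a) (a≢b ∘ sym) = refl

count≤1 : ∀ {n} {p : Fin n → Bool} → (∀ a b → p a ≡ true → p b ≡ true → a ≡ b) → count p ≤ 1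
count≤1 {n} {p} subsingleton with Finₚ.any? (λ a → p a Boolₚ.≟ true)
... | no ∄a        = subst (_≤ 1) (sym (count-none (λ a → Boolₚ.¬-not (λ pa → ∄a (a , pa))))) z≤n
... | yes (a , pa) = ℕₚ.≤-reflexive (trans (count-remove p a pa) (cong suc (count-none only-a)))
  where
  only-a : ∀ b → (p b ∧ not (does (b Finₚ.≟ a))) ≡ false
  only-a b with p b in pb
  ... | false = refl
  ... | true  rewrite dec-true (b Finₚ.≟ a) (subsingleton b a pb pa) = refl

injective⇒surjective : ∀ {m n} (f : Fin m → Fin n) → Injective _≡_ _≡_ f → n ≤ m → ∀ u → ∃ λ i → f i ≡ u
injective⇒surjective {m} {suc n} f f-injective n≤m u with Finₚ.any? (λ i → f i Finₚ.≟ u)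
... | yes hit = hit
... | no miss = ⊥-elim (ℕₚ.<-irrefl refl (ℕₚ.≤-trans n≤m (Finₚ.injective⇒≤ f-avoiding-u-injective)))
  where
  u≢f : ∀ i → u ≢ f i
  u≢f i u≡fi = miss (i , sym u≡fi)
  f-avoiding-u : Fin m → Fin n
  f-avoiding-u i = punchOut (u≢f i)
  f-avoiding-u-injective : Injective _≡_ _≡_ f-avoiding-u
  f-avoiding-u-injective {i} {j} eq = f-injective (Finₚ.punchOut-injective (u≢f i) (u≢f j) eq)

-- Edge counting

degree-sum : Graph → ℕ
degree-sum G = ∑[ i < V G ] ∑[ j < V G ] [ adj G i j ]

<ᵇ-flip : ∀ m n → m ≢ n → (n <ᵇ m) ≡ not (m <ᵇ n)
<ᵇ-flip zero    zero    m≢n = contradiction refl m≢n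
<ᵇ-flip zero    (suc n) m≢n = refl
<ᵇ-flip (suc m) zero    m≢n = refl
<ᵇ-flip (suc m) (suc n) m≢n = <ᵇ-flip m n (m≢n ∘ cong suc)

module _ (G : Graph) where

  private
    n : ℕ
    n = V G
    forward : Fin n → Fin n → ℕ
    forward i j = [ adj G i j ∧ (toℕ i <ᵇ toℕ j) ]

  e≡sum-forward : e G ≡ ∑[ i < n ] ∑[ j < n ] forward i j
  e≡sum-forward = trans (sum-allFin (λ i → List.sum (map (entry i) (allFin n)))) (sum-cong-≗ λ i →
    trans (sum-allFin (entry i)) (sum-cong-≗ λ j → if-1-0≡[] (adj G i j ∧ (toℕ i <ᵇ toℕ j))))
    where
    entry : Fin n → Fin n → ℕ
    entry i j = if adj G i j ∧ (toℕ i <ᵇ toℕ j) then 1 else 0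

  adj-forward-backward : ∀ i j → [ adj G i j ] ≡ forward i j + forward j i
  adj-forward-backward i j with i Finₚ.≟ j
  ... | yes refl rewrite adj-irrefl G i = refl
  ... | no i≢j rewrite adj-sym G j i | <ᵇ-flip (toℕ i) (toℕ j) (i≢j ∘ Finₚ.toℕ-injective) =
    []-split (adj G i j) (toℕ i <ᵇ toℕ j)

  handshake : degree-sum G ≡ 2 * e G
  handshake = begin
    ∑[ i < n ] ∑[ j < n ] [ adj G i j ]
      ≡⟨ sum-cong-≗ (λ i → trans (sum-cong-≗ (adj-forward-backward i))
                                 (∑-distrib-+ (forward i) (λ j → forward j i))) ⟩
    ∑[ i < n ] (∑[ j < n ] forward i j + ∑[ j < n ] forward j i)
      ≡⟨ ∑-distrib-+ (λ i → ∑[ j < n ] forward i j) (λ i → ∑[ j < n ] forward j i) ⟩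
    ∑[ i < n ] ∑[ j < n ] forward i j + ∑[ i < n ] ∑[ j < n ] forward j i
      ≡⟨ cong (∑[ i < n ] ∑[ j < n ] forward i j +_) (∑-comm (λ i j → forward j i)) ⟩
    ∑[ i < n ] ∑[ j < n ] forward i j + ∑[ j < n ] ∑[ i < n ] forward j i
      ≡⟨ cong₂ _+_ (sym e≡sum-forward) (sym e≡sum-forward) ⟩
    e G + e G
      ≡⟨ cong (e G +_) (sym (ℕₚ.+-identityʳ (e G))) ⟩
    2 * e G ∎
    where open ≡-Reasoning

v≤1⇒degree-sum≡0 : ∀ G → V G ≤ 1 → degree-sum G ≡ 0
v≤1⇒degree-sum≡0 G v≤1 with V G | adj G | adj-irrefl G
... | zero        | _ | _      = refl
... | suc zero    | _ | irrefl rewrite irrefl zero = refl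
... | suc (suc _) | _ | _      = contradiction v≤1 λ { (s≤s ()) }

e≡0⊎2≤v : ∀ G → e G ≡ 0 ⊎ 2 ≤ V G
e≡0⊎2≤v G with V G ℕ.≤? 1
... | yes v≤1 = inj₁ (ℕₚ.m+n≡0⇒m≡0 (e G) (trans (sym (handshake G)) (v≤1⇒degree-sum≡0 G v≤1)))
... | no  v≰1 = inj₂ (ℕₚ.≰⇒> v≰1)

-- Densities

toℚᵘ-/ : ∀ a b → toℚᵘ ((ℤ.+ a) / suc b) ℚᵘ.≃ mkℚᵘ (ℤ.+ a) b
toℚᵘ-/ a b = ℚₚ.toℚᵘ-fromℚᵘ (mkℚᵘ (ℤ.+ a) b)

/-≤⇒*-≤ : ∀ a b c d → (ℤ.+ a) / suc b ℚ.≤ (ℤ.+ c) / suc d → a * suc d ≤ c * suc b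
/-≤⇒*-≤ a b c d p≤q
  with ℚᵘₚ.≤-respʳ-≃ (toℚᵘ-/ c d) (ℚᵘₚ.≤-respˡ-≃ (toℚᵘ-/ a b) (ℚₚ.toℚᵘ-mono-≤ p≤q))
... | *≤* ad≤cb rewrite sym (ℤₚ.pos-* a (suc d)) | sym (ℤₚ.pos-* c (suc b)) = ℤₚ.drop‿+≤+ ad≤cb

/-<⇒*-< : ∀ a b c d → (ℤ.+ a) / suc b ℚ.< (ℤ.+ c) / suc d → a * suc d < c * suc b
/-<⇒*-< a b c d p<q
  with ℚᵘₚ.<-respʳ-≃ (toℚᵘ-/ c d) (ℚᵘₚ.<-respˡ-≃ (toℚᵘ-/ a b) (ℚₚ.toℚᵘ-mono-< p<q))
... | *<* ad<cb rewrite sym (ℤₚ.pos-* a (suc d)) | sym (ℤₚ.pos-* c (suc b)) = ℤₚ.drop‿+<+ ad<cb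

*-<⇒/-< : ∀ a b c d → a * suc d < c * suc b → (ℤ.+ a) / suc b ℚ.< (ℤ.+ c) / suc d
*-<⇒/-< a b c d ad<cb = ℚₚ.toℚᵘ-cancel-<
  (ℚᵘₚ.<-respʳ-≃ (ℚᵘₚ.≃-sym (toℚᵘ-/ c d)) (ℚᵘₚ.<-respˡ-≃ (ℚᵘₚ.≃-sym (toℚᵘ-/ a b))
    (*<* (subst₂ ℤ._<_ (ℤₚ.pos-* a (suc d)) (ℤₚ.pos-* c (suc b)) (ℤ.+<+ ad<cb)))))

ρ₁-pos : ∀ G → 0ℚ ℚ.< ρ₁ G → 1 ≤ e G × 2 ≤ V G
ρ₁-pos G = positive (e G) (V G)
  where
  positive : ∀ m n → 0ℚ ℚ.< ρ₁-aux m n → 1 ≤ m × 2 ≤ n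
  positive zero    n             0<ρ = contradiction 0<ρ (ℚₚ.<-irrefl refl)
  positive (suc m) zero          0<ρ = contradiction 0<ρ (ℚₚ.<-irrefl refl)
  positive (suc m) (suc zero)    0<ρ = contradiction 0<ρ (ℚₚ.<-irrefl refl)
  positive (suc m) (suc (suc n)) 0<ρ = s≤s z≤n , s≤s (s≤s z≤n)

ρ₁-≤⇒*-≤ : ∀ H G → 0ℚ ℚ.< ρ₁ G → ρ₁ H ℚ.≤ ρ₁ G → e H * (V G ∸ 1) ≤ e G * (V H ∸ 1)
ρ₁-≤⇒*-≤ H G 0<ρG ρH≤ρG with e≡0⊎2≤v H | ρ₁-pos G 0<ρG
... | inj₁ eH≡0 | _           = subst (λ m → m * (V G ∸ 1) ≤ e G * (V H ∸ 1)) (sym eH≡0) z≤n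
... | inj₂ 2≤vH | 1≤eG , 2≤vG = cross (e H) (V H) (e G) (V G) 2≤vH 1≤eG 2≤vG ρH≤ρG
  where
  cross : ∀ a h c g → 2 ≤ h → 1 ≤ c → 2 ≤ g → ρ₁-aux a h ℚ.≤ ρ₁-aux c g → a * (g ∸ 1) ≤ c * (h ∸ 1)
  cross zero    _             _       _             _        _ _        _   = z≤n
  cross (suc a) (suc (suc h)) (suc c) (suc (suc g)) _        _ _        ρ≤ρ = /-≤⇒*-≤ (suc a) h (suc c) g ρ≤ρ
  cross (suc a) (suc zero)    _       _             (s≤s ()) _ _        _
  cross (suc a) (suc (suc h)) (suc c) (suc zero)    _        _ (s≤s ()) _

ρ₁-<⇒*-< : ∀ H G → 2 ≤ V H → 0ℚ ℚ.< ρ₁ G → ρ₁ H ℚ.< ρ₁ G → e H * (V G ∸ 1) < e G * (V H ∸ 1)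
ρ₁-<⇒*-< H G 2≤vH 0<ρG ρH<ρG with ρ₁-pos G 0<ρG
... | 1≤eG , 2≤vG = cross (e H) (V H) (e G) (V G) 2≤vH 1≤eG 2≤vG ρH<ρG
  where
  cross : ∀ a h c g → 2 ≤ h → 1 ≤ c → 2 ≤ g → ρ₁-aux a h ℚ.< ρ₁-aux c g → a * (g ∸ 1) < c * (h ∸ 1)
  cross zero    (suc (suc h)) (suc c) (suc (suc g)) _        _ _        _   = s≤s z≤n
  cross (suc a) (suc (suc h)) (suc c) (suc (suc g)) _        _ _        ρ<ρ = /-<⇒*-< (suc a) h (suc c) g ρ<ρ
  cross _       (suc zero)    _       _             (s≤s ()) _ _        _
  cross _       (suc (suc h)) (suc c) (suc zero)    _        _ (s≤s ()) _

*-<⇒dens-< : ∀ H G → 1 ≤ V H → 1 ≤ V G → e H * V G < e G * V H → dens H ℚ.< dens G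
*-<⇒dens-< H G 1≤vH 1≤vG = cross (e H) (V H) (e G) (V G) 1≤vH 1≤vG
  where
  cross : ∀ a h c g → 1 ≤ h → 1 ≤ g → a * g < c * h → dens-aux a h ℚ.< dens-aux c g
  cross a (suc h) c (suc g) _ _ = *-<⇒/-< a h c g

∸1+∸1 : ∀ a b → 1 ≤ a → 1 ≤ b → (a ∸ 1) + (b ∸ 1) ≡ a + b ∸ 2
∸1+∸1 (suc a) (suc b) _ _ = sym (cong (_∸ 1) (ℕₚ.+-suc a b))

cross-sum-≤ : ∀ {e vA vB m} eA eB → eA + eB ≡ e → 1 ≤ vA → 1 ≤ vB →
              eA * m ≤ e * (vA ∸ 1) → eB * m ≤ e * (vB ∸ 1) → e * m ≤ e * (vA + vB ∸ 2)
cross-sum-≤ {e} {vA} {vB} {m} eA eB eA+eB≡e 1≤vA 1≤vB boundA boundB = begin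
  e * m                         ≡⟨ cong (_* m) eA+eB≡e ⟨
  (eA + eB) * m                 ≡⟨ ℕₚ.*-distribʳ-+ m eA eB ⟩
  eA * m + eB * m               ≤⟨ ℕₚ.+-mono-≤ boundA boundB ⟩
  e * (vA ∸ 1) + e * (vB ∸ 1)   ≡⟨ ℕₚ.*-distribˡ-+ e (vA ∸ 1) (vB ∸ 1) ⟨
  e * ((vA ∸ 1) + (vB ∸ 1))     ≡⟨ cong (e *_) (∸1+∸1 vA vB 1≤vA 1≤vB) ⟩
  e * (vA + vB ∸ 2)             ∎
  where open ℕₚ.≤-Reasoning

cross-sum-< : ∀ {e vA vB m} eA eB → eA + eB ≡ e → 1 ≤ vA → 1 ≤ vB →
              eA * m < e * (vA ∸ 1) → eB * m < e * (vB ∸ 1) → e * m < e * (vA + vB ∸ 2)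
cross-sum-< {e} {vA} {vB} {m} eA eB eA+eB≡e 1≤vA 1≤vB boundA boundB = begin-strict
  e * m                         ≡⟨ cong (_* m) eA+eB≡e ⟨
  (eA + eB) * m                 ≡⟨ ℕₚ.*-distribʳ-+ m eA eB ⟩
  eA * m + eB * m               <⟨ ℕₚ.+-mono-< boundA boundB ⟩
  e * (vA ∸ 1) + e * (vB ∸ 1)   ≡⟨ ℕₚ.*-distribˡ-+ e (vA ∸ 1) (vB ∸ 1) ⟨
  e * ((vA ∸ 1) + (vB ∸ 1))     ≡⟨ cong (e *_) (∸1+∸1 vA vB 1≤vA 1≤vB) ⟩
  e * (vA + vB ∸ 2)             ∎
  where open ℕₚ.≤-Reasoning

e*∸1≰e*∸2 : ∀ e n → 1 ≤ e → 2 ≤ n → ¬ (e * (n ∸ 1) ≤ e * (n ∸ 2))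
e*∸1≰e*∸2 (suc e) (suc (suc n)) _ _        le = ℕₚ.1+n≰n (ℕₚ.*-cancelˡ-≤ (suc e) le)
e*∸1≰e*∸2 (suc e) (suc zero)    _ (s≤s ()) _

m+n≤1+o∧2≤n⇒m<o : ∀ {m n o} → m + n ≤ suc o → 2 ≤ n → m < o
m+n≤1+o∧2≤n⇒m<o {m} m+n≤1+o 2≤n =
  ℕₚ.≤-pred (ℕₚ.≤-trans (ℕₚ.≤-reflexive (ℕₚ.+-comm 2 m)) (ℕₚ.≤-trans (ℕₚ.+-monoʳ-≤ m 2≤n) m+n≤1+o))

cross-≤⇒e-< : ∀ {eH eG vH vG} → 1 ≤ eG → 1 ≤ vH → vH < vG → eH * (vG ∸ 1) ≤ eG * (vH ∸ 1) → eH < eG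
cross-≤⇒e-< {eH} {suc c} {suc h} {suc g} _ _ vH<vG cross =
  ℕₚ.*-cancelʳ-< g eH (suc c) (ℕₚ.≤-<-trans cross (ℕₚ.*-monoʳ-< (suc c) (ℕₚ.≤-pred vH<vG)))

cross-≤⇒*-< : ∀ {eH eG vH vG} → 1 ≤ vH → 1 ≤ vG → eH * (vG ∸ 1) ≤ eG * (vH ∸ 1) → eH < eG →
              eH * vG < eG * vH
cross-≤⇒*-< {eH} {eG} {suc h} {suc g} _ _ cross eH<eG =
  subst₂ _<_ (sym (ℕₚ.*-suc eH g)) (sym (ℕₚ.*-suc eG h)) (ℕₚ.+-mono-<-≤ eH<eG cross)

-- Subgraphs and minors

≅⇒V≡ : ∀ {H G} → H ≅ G → V H ≡ V G
≅⇒V≡ (φ , _) =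
  Finₚ.cantor-schröder-bernstein (Injection.injective (↔⇒↣ φ)) (Injection.injective (↔⇒↣ (↔-sym φ)))

module _ {H G : Graph} (f : Fin (V H) → Fin (V G)) (f-injective : Injective _≡_ _≡_ f) where

  private
    preimage : Fin (V G) → Maybe (Fin (V H))
    preimage u with Finₚ.any? (λ h → f h Finₚ.≟ u)
    ... | yes (h , _) = just h
    ... | no _        = nothing

    preimage-just : ∀ {u h} → preimage u ≡ just h → f h ≡ u
    preimage-just {u} eq with Finₚ.any? (λ h → f h Finₚ.≟ u)
    preimage-just refl | yes (h , fh≡u) = fh≡u

    preimage-image : ∀ h → preimage (f h) ≡ just h
    preimage-image h with Finₚ.any? (λ h′ → f h′ Finₚ.≟ f h)
    ... | yes (h′ , fh′≡fh) = cong just (f-injective fh′≡fh)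
    ... | no ∄h′            = contradiction (h , refl) ∄h′

  subgraph-≼ : (∀ h h′ → Adj H h h′ → Adj G (f h) (f h′)) → H ≼ G
  subgraph-≼ f-adj = preimage , (λ h → f h , preimage-image h) , singleton-connected , edges
    where
    singleton-connected : ∀ h → ConnectedIn G (λ u → preimage u ≡ just h)
    singleton-connected h u w βu≡h βw≡h =
      subst (Walk G _ u) (trans (sym (preimage-just βu≡h)) (preimage-just βw≡h)) (stop βu≡h)
    edges : ∀ h h′ → Adj H h h′ →
            ∃ λ u → ∃ λ u′ → preimage u ≡ just h × preimage u′ ≡ just h′ × Adj G u u′
    edges h h′ hh′ = f h , f h′ , preimage-image h , preimage-image h′ , f-adj h h′ hh′

embed : ∀ {n} (p : Fin n → Bool) → Fin (count p) → Fin n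
embed {suc n} p i       with p zero
embed {suc n} p zero    | true  = zero
embed {suc n} p (suc i) | true  = suc (embed (p ∘ suc) i)
embed {suc n} p i       | false = suc (embed (p ∘ suc) i)

embed-injective : ∀ {n} (p : Fin n → Bool) → Injective _≡_ _≡_ (embed p)
embed-injective {suc n} p {i} {j} eq with p zero
embed-injective {suc n} p {zero}  {zero}  eq | true  = refl
embed-injective {suc n} p {suc i} {suc j} eq | true  =
  cong suc (embed-injective (p ∘ suc) (Finₚ.suc-injective eq))
embed-injective {suc n} p {i}     {j}     eq | false = embed-injective (p ∘ suc) (Finₚ.suc-injective eq)

sum-embed : ∀ {n} (p : Fin n → Bool) (f : Fin n → ℕ) →
            ∑[ i < count p ] f (embed p i) ≡ ∑[ a < n ] (if p a then f a else 0)
sum-embed {zero}  p f = refl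
sum-embed {suc n} p f with p zero
... | true  = cong (f zero +_) (sum-embed (p ∘ suc) (f ∘ suc))
... | false = sum-embed (p ∘ suc) (f ∘ suc)

induced : (G : Graph) → (Fin (V G) → Bool) → Graph
induced G p = record
  { V          = count p
  ; adj        = λ i j → adj G (embed p i) (embed p j)
  ; adj-sym    = λ i j → adj-sym G (embed p i) (embed p j)
  ; adj-irrefl = λ i → adj-irrefl G (embed p i)
  }

induced-≼ : ∀ G p → induced G p ≼ G
induced-≼ G p = subgraph-≼ {induced G p} {G} (embed p) (embed-injective p) (λ _ _ ij → ij)

induced-≺ : ∀ G p → count p < V G → induced G p ≺ G
induced-≺ G p p<n = induced-≼ G p , λ iso → ℕₚ.<-irrefl (≅⇒V≡ {induced G p} {G} iso) p<n

degree-sum-induced : ∀ G p → degree-sum (induced G p) ≡ ∑[ a < V G ] ∑[ b < V G ] [ p a ∧ p b ∧ adj G a b ]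
degree-sum-induced G p = begin
  ∑[ i < count p ] ∑[ j < count p ] [ adj G (embed p i) (embed p j) ]
    ≡⟨ sum-cong-≗ (λ i → sum-embed p (λ b → [ adj G (embed p i) b ])) ⟩
  ∑[ i < count p ] ∑[ b < n ] (if p b then [ adj G (embed p i) b ] else 0)
    ≡⟨ sum-embed p (λ a → ∑[ b < n ] (if p b then [ adj G a b ] else 0)) ⟩
  ∑[ a < n ] (if p a then ∑[ b < n ] (if p b then [ adj G a b ] else 0) else 0)
    ≡⟨ sum-cong-≗ (λ a → sum-if (p a) (λ b → if p b then [ adj G a b ] else 0)) ⟩
  ∑[ a < n ] ∑[ b < n ] (if p a then (if p b then [ adj G a b ] else 0) else 0)
    ≡⟨ sum-cong-≗ (λ a → sum-cong-≗ λ b →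
         trans (cong (λ t → if p a then t else 0) (if-[] (p b) (adj G a b))) (if-[] (p a) (p b ∧ adj G a b))) ⟩
  ∑[ a < n ] ∑[ b < n ] [ p a ∧ p b ∧ adj G a b ] ∎
  where
  n : ℕ
  n = V G
  open ≡-Reasoning

module _ {H G : Graph} (π : Fin (V H) ↔ Fin (V G)) where

  private
    n : ℕ
    n = V H
    to : Fin (V H) → Fin (V G)
    to = Inverse.to π

  degree-sum-permute : degree-sum G ≡ ∑[ h < n ] ∑[ h′ < n ] [ adj G (to h) (to h′) ]
  degree-sum-permute = trans (sum-permute (λ a → ∑[ b < V G ] [ adj G a b ]) π)
                             (sum-cong-≗ λ h → sum-permute (λ b → [ adj G (to h) b ]) π)

  edge-preserving-bijection⇒e-< : (∀ h h′ → Adj H h h′ → Adj G (to h) (to h′)) → ¬ (H ≅ G) → e H < e G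
  edge-preserving-bijection⇒e-< preserves H≇G =
    ℕₚ.*-cancelˡ-< 2 (e H) (e G) (subst₂ _<_ (handshake H) (handshake G) (ℕₚ.≤∧≢⇒< DH≤DG DH≢DG))
    where
    pointwise : ∀ h h′ → [ adj H h h′ ] ≤ [ adj G (to h) (to h′) ]
    pointwise h h′ = []-mono (preserves h h′)
    DH≤DG : degree-sum H ≤ degree-sum G
    DH≤DG = subst (degree-sum H ≤_) (sym degree-sum-permute) (sum-mono-≤ λ h → sum-mono-≤ (pointwise h))
    DH≢DG : degree-sum H ≢ degree-sum G
    DH≢DG DH≡DG = H≇G (π , λ h h′ → []-injective (sum-≡-≤⇒≗ (pointwise h) (rows-equal h) h′))
      where
      rows-equal : ∀ h → ∑[ h′ < n ] [ adj H h h′ ] ≡ ∑[ h′ < n ] [ adj G (to h) (to h′) ]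
      rows-equal = sum-≡-≤⇒≗ (λ h → sum-mono-≤ (pointwise h)) (trans DH≡DG degree-sum-permute)

module _ {H G : Graph} (H≼G : H ≼ G) where

  private
    β : Fin (V G) → Maybe (Fin (V H))
    β = proj₁ H≼G

  representative : Fin (V H) → Fin (V G)
  representative h = proj₁ (proj₁ (proj₂ H≼G) h)

  β-representative : ∀ h → β (representative h) ≡ just h
  β-representative h = proj₂ (proj₁ (proj₂ H≼G) h)

  representative-injective : Injective _≡_ _≡_ representative
  representative-injective {h} {h′} eq =
    Maybeₚ.just-injective (trans (sym (β-representative h)) (trans (cong β eq) (β-representative h′)))

  ≼⇒V≤ : V H ≤ V G
  ≼⇒V≤ = Finₚ.injective⇒≤ representative-injective

  ≺-same-order⇒e-< : ¬ (H ≅ G) → V G ≤ V H → e H < e G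
  ≺-same-order⇒e-< H≇G vG≤vH = edge-preserving-bijection⇒e-< {H} {G} π preserves H≇G
    where
    onto : ∀ u → ∃ λ h → representative h ≡ u
    onto = injective⇒surjective representative representative-injective vG≤vH
    π : Fin (V H) ↔ Fin (V G)
    π = mk↔ₛ′ representative (proj₁ ∘ onto) (proj₂ ∘ onto)
              (λ h → representative-injective (proj₂ (onto (representative h))))
    branch-set-is-singleton : ∀ {h u} → β u ≡ just h → representative h ≡ u
    branch-set-is-singleton {h} {u} βu≡h with onto u
    ... | h′ , refl = cong representative (Maybeₚ.just-injective (trans (sym βu≡h) (β-representative h′)))
    preserves : ∀ h h′ → Adj H h h′ → Adj G (representative h) (representative h′)
    preserves h h′ hh′ with proj₂ (proj₂ (proj₂ H≼G)) h h′ hh′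
    ... | u , u′ , βu≡h , βu′≡h′ , uu′
      rewrite branch-set-is-singleton βu≡h | branch-set-is-singleton βu′≡h′ = uu′

-- Walks

module _ {G : Graph} where

  private
    variable
      P Q : Fin (V G) → Set
      u w x : Fin (V G)

  walk-map : (∀ {a} → P a → Q a) → Walk G P u w → Walk G Q u w
  walk-map f (stop Pu)       = stop (f Pu)
  walk-map f (step Pu uy yw) = step (f Pu) uy (walk-map f yw)

  walk-head : Walk G P u w → P u
  walk-head (stop Pu)     = Pu
  walk-head (step Pu _ _) = Pu

  walk-last : Walk G P u w → P w
  walk-last (stop Pw)     = Pw
  walk-last (step _ _ yw) = walk-last yw

  walk-snoc : Walk G P u w → Adj G w x → P x → Walk G P u x
  walk-snoc (stop Pu)       wx Px = step Pu wx (stop Px)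
  walk-snoc (step Pu uy yw) wx Px = step Pu uy (walk-snoc yw wx Px)

  last-exit : ∀ x → w ≢ x → Walk G P u w →
              Walk G (λ a → P a × a ≢ x) u w ⊎ ∃ λ y → Adj G x y × Walk G (λ a → P a × a ≢ x) y w
  last-exit x w≢x (stop Pw) = inj₁ (stop (Pw , w≢x))
  last-exit {u = u} x w≢x (step Pu uy yw) with last-exit x w≢x yw
  ... | inj₂ exit = inj₂ exit
  ... | inj₁ yw′ with u Finₚ.≟ x
  ...   | yes refl = inj₂ (_ , uy , yw′)
  ...   | no u≢x   = inj₁ (step (Pu , u≢x) uy yw′)

module _ (G : Graph) where

  private
    n : ℕ
    n = V G

  -- Recursion on the number of allowed vertices: a walk from u ≢ w leaves u
  -- for the last time to a neighbour y, and from there avoids u (last-exit).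
  walk?-bounded : ∀ k {P : Fin n → Set} (P? : Decidable P) → count (λ a → does (P? a)) ≡ k →
                  ∀ u w → Dec (Walk G P u w)
  walk?-bounded k P? size u w with P? u | u Finₚ.≟ w
  ... | no ¬Pu | _        = no (¬Pu ∘ walk-head)
  ... | yes Pu | yes refl = yes (stop Pu)
  walk?-bounded zero    P? size u w | yes Pu | no _ =
    contradiction (trans (sym size) (count-remove _ u (dec-true (P? u) Pu))) λ ()
  walk?-bounded (suc k) {P} P? size u w | yes Pu | no u≢w
    with Finₚ.any? (λ y → (adj G u y Boolₚ.≟ true) ×-dec walk?-bounded k P∖u? size′ y w)
    where
    P∖u? : Decidable (λ a → P a × a ≢ u)
    P∖u? a = P? a ×-dec ¬? (a Finₚ.≟ u)
    size′ : count (λ a → does (P∖u? a)) ≡ k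
    size′ = ℕₚ.suc-injective (trans (sym (count-remove _ u (dec-true (P? u) Pu))) size)
  ... | yes (y , uy , yw) = yes (step Pu uy (walk-map proj₁ yw))
  ... | no ∄y = no λ uw → [ (λ uw′ → proj₂ (walk-head uw′) refl) , ∄y ]′ (last-exit u (u≢w ∘ sym) uw)

  walk? : ∀ {P : Fin n → Set} → Decidable P → ∀ u w → Dec (Walk G P u w)
  walk? P? = walk?-bounded _ P? refl

-- Separations

-- A ∪ B = V(G) and no edge joins A ∖ B to B ∖ A; given the cover,
-- a ∈ A ∖ B is expressed as B a ≡ false.
record Separation (G : Graph) : Set where
  field
    A B       : Fin (V G) → Bool
    cover     : ∀ a → (A a ∨ B a) ≡ true
    separates : ∀ a b → Adj G a b → B a ≡ false → A b ≡ false → ⊥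

exactly-one-side : ∀ {Aa Ba Ab Bb} → (Aa ∨ Ba) ≡ true → (Ab ∨ Bb) ≡ true →
                   (Ba ≡ false → Ab ≡ false → ⊥) → (Bb ≡ false → Aa ≡ false → ⊥) →
                   ((Aa ∧ Ba) ≡ true → (Ab ∧ Bb) ≡ true → ⊥) →
                   [ Aa ∧ Ab ] + [ Ba ∧ Bb ] ≡ 1
exactly-one-side {true}  {true}  {true}  {true}  _  _  _   _   both = ⊥-elim (both refl refl)
exactly-one-side {true}  {true}  {true}  {false} _  _  _   _   _    = refl
exactly-one-side {true}  {true}  {false} {true}  _  _  _   _   _    = refl
exactly-one-side {true}  {false} {true}  {true}  _  _  _   _   _    = refl
exactly-one-side {true}  {false} {true}  {false} _  _  _   _   _    = refl
exactly-one-side {true}  {false} {false} {true}  _  _  sep _   _    = ⊥-elim (sep refl refl)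
exactly-one-side {false} {true}  {true}  {true}  _  _  _   _   _    = refl
exactly-one-side {false} {true}  {true}  {false} _  _  _   sep _    = ⊥-elim (sep refl refl)
exactly-one-side {false} {true}  {false} {true}  _  _  _   _   _    = refl
exactly-one-side {false} {false} {_}     {_}     () _  _   _   _
exactly-one-side {_}     {_}     {false} {false} _  () _   _   _

module _ {G : Graph} (S : Separation G) where

  open Separation S

  both : Fin (V G) → Bool
  both a = A a ∧ B a

  count-separation : count A + count B ≡ V G + count both
  count-separation = begin
    count A + count B                         ≡⟨ ∑-distrib-+ (λ a → [ A a ]) (λ a → [ B a ]) ⟨
    ∑[ a < V G ] ([ A a ] + [ B a ])          ≡⟨ sum-cong-≗ (λ a → []-∨-∧ (A a) (B a)) ⟩
    ∑[ a < V G ] ([ A a ∨ B a ] + [ both a ]) ≡⟨ ∑-distrib-+ (λ a → [ A a ∨ B a ]) (λ a → [ both a ]) ⟩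
    count (λ a → A a ∨ B a) + count both      ≡⟨ cong (_+ count both) (count-all cover) ⟩
    V G + count both                          ∎
    where open ≡-Reasoning

  module _ (both-subsingleton : ∀ a b → both a ≡ true → both b ≡ true → a ≡ b) where

    adj-split : ∀ a b → [ adj G a b ] ≡ [ A a ∧ A b ∧ adj G a b ] + [ B a ∧ B b ∧ adj G a b ]
    adj-split a b with adj G a b in ab
    ... | false rewrite ∧-zeroʳ (A b) | ∧-zeroʳ (A a) | ∧-zeroʳ (B b) | ∧-zeroʳ (B a) = refl
    ... | true  rewrite ∧-identityʳ (A b) | ∧-identityʳ (B b) =
      sym (exactly-one-side (cover a) (cover b) (separates a b ab)
                            (separates b a (trans (adj-sym G b a) ab))
                            (λ a∈A∩B b∈A∩B → loop (both-subsingleton a b a∈A∩B b∈A∩B)))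
      where
      loop : a ≢ b
      loop refl = contradiction (trans (sym ab) (adj-irrefl G a)) λ ()

    e-separation : e G ≡ e (induced G A) + e (induced G B)
    e-separation = ℕₚ.*-cancelˡ-≡ (e G) _ 2 (begin
      2 * e G                                            ≡⟨ handshake G ⟨
      degree-sum G                                       ≡⟨ sum-cong-≗ (λ a → sum-cong-≗ (adj-split a)) ⟩
      ∑[ a < n ] ∑[ b < n ] (within A a b + within B a b)
        ≡⟨ sum-cong-≗ (λ a → ∑-distrib-+ (within A a) (within B a)) ⟩
      ∑[ a < n ] (∑[ b < n ] within A a b + ∑[ b < n ] within B a b)
        ≡⟨ ∑-distrib-+ (λ a → ∑[ b < n ] within A a b) (λ a → ∑[ b < n ] within B a b) ⟩
      ∑[ a < n ] ∑[ b < n ] within A a b + ∑[ a < n ] ∑[ b < n ] within B a b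
        ≡⟨ cong₂ _+_ (degree-sum-induced G A) (degree-sum-induced G B) ⟨
      degree-sum (induced G A) + degree-sum (induced G B)
        ≡⟨ cong₂ _+_ (handshake (induced G A)) (handshake (induced G B)) ⟩
      2 * e (induced G A) + 2 * e (induced G B)
        ≡⟨ ℕₚ.*-distribˡ-+ 2 (e (induced G A)) (e (induced G B)) ⟨
      2 * (e (induced G A) + e (induced G B))            ∎)
      where
      n : ℕ
      n = V G
      within : (Fin n → Bool) → Fin n → Fin n → ℕ
      within p a b = [ p a ∧ p b ∧ adj G a b ]
      open ≡-Reasoning

open Separation using (A; B)

balanced-separation-not-disjoint : ∀ {G} → OneMinorBalanced G → (S : Separation G) →
                                   1 ≤ count (A S) → 1 ≤ count (B S) → ¬ (∀ a → both S a ≡ false)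
balanced-separation-not-disjoint {G} (0<ρ , balanced) S 1≤vA 1≤vB disjoint =
  e*∸1≰e*∸2 (e G) (V G) (proj₁ (ρ₁-pos G 0<ρ)) (proj₂ (ρ₁-pos G 0<ρ))
    (subst (λ m → e G * (V G ∸ 1) ≤ e G * (m ∸ 2)) vA+vB≡n
      (cross-sum-≤ (e (induced G (A S))) (e (induced G (B S))) (sym (e-separation S never-both))
                   1≤vA 1≤vB (side (A S)) (side (B S))))
  where
  never-both : ∀ a b → both S a ≡ true → both S b ≡ true → a ≡ b
  never-both a _ a∈A∩B _ = contradiction (trans (sym a∈A∩B) (disjoint a)) λ ()
  vA+vB≡n : count (A S) + count (B S) ≡ V G
  vA+vB≡n = trans (count-separation S) (trans (cong (V G +_) (count-none disjoint)) (ℕₚ.+-identityʳ (V G)))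
  side : ∀ p → e (induced G p) * (V G ∸ 1) ≤ e G * (count p ∸ 1)
  side p = ρ₁-≤⇒*-≤ (induced G p) G 0<ρ (balanced (induced G p) (induced-≼ G p))

strictly-balanced-separation-not-thin : ∀ {G} → StrictlyOneMinorBalanced G → (S : Separation G) →
  2 ≤ count (A S) → 2 ≤ count (B S) → ¬ (∀ a b → both S a ≡ true → both S b ≡ true → a ≡ b)
strictly-balanced-separation-not-thin {G} (0<ρ , strictly-balanced) S 2≤vA 2≤vB thin =
  ℕₚ.<-irrefl refl (ℕₚ.<-≤-trans
    (cross-sum-< (e (induced G (A S))) (e (induced G (B S))) (sym (e-separation S thin))
                 (ℕₚ.≤-trans (s≤s z≤n) 2≤vA) (ℕₚ.≤-trans (s≤s z≤n) 2≤vB)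
                 (side (A S) 2≤vA (m+n≤1+o∧2≤n⇒m<o vA+vB≤1+n 2≤vB))
                 (side (B S) 2≤vB (m+n≤1+o∧2≤n⇒m<o vB+vA≤1+n 2≤vA)))
    (ℕₚ.*-monoʳ-≤ (e G) (ℕₚ.∸-monoˡ-≤ 2 vA+vB≤1+n)))
  where
  vA+vB≤1+n : count (A S) + count (B S) ≤ suc (V G)
  vA+vB≤1+n = begin
    count (A S) + count (B S) ≡⟨ count-separation S ⟩
    V G + count (both S)      ≤⟨ ℕₚ.+-monoʳ-≤ (V G) (count≤1 thin) ⟩
    V G + 1                   ≡⟨ ℕₚ.+-comm (V G) 1 ⟩
    suc (V G)                 ∎
    where open ℕₚ.≤-Reasoning
  vB+vA≤1+n : count (B S) + count (A S) ≤ suc (V G)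
  vB+vA≤1+n = subst (_≤ suc (V G)) (ℕₚ.+-comm (count (A S)) (count (B S))) vA+vB≤1+n
  side : ∀ p → 2 ≤ count p → count p < V G → e (induced G p) * (V G ∸ 1) < e G * (count p ∸ 1)
  side p 2≤vp vp<n = ρ₁-<⇒*-< (induced G p) G 2≤vp 0<ρ (strictly-balanced (induced G p) (induced-≺ G p vp<n))

module Reachability (G : Graph) {P : Fin (V G) → Set} (P? : Decidable P) (u : Fin (V G)) where

  reachable : Fin (V G) → Bool
  reachable a = does (walk? G P? u a)

  reachable-sound : ∀ {a} → reachable a ≡ true → Walk G P u a
  reachable-sound {a} ra with walk? G P? u a
  reachable-sound ra | yes ua = ua

  reachable-complete : ∀ {a} → Walk G P u a → reachable a ≡ true
  reachable-complete {a} = dec-true (walk? G P? u a)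

  reachable⇒P : ∀ {a} → reachable a ≡ true → P a
  reachable⇒P = walk-last ∘ reachable-sound

  reachable-closed : ∀ {a b} → reachable a ≡ true → Adj G a b → P b → reachable b ≡ true
  reachable-closed ra ab Pb = reachable-complete (walk-snoc (reachable-sound ra) ab Pb)

  -- The sides are (reachable ∪ ∁ P) and ∁ reachable, so the overlap is ∁ P.
  separation : Separation G
  separation = record
    { A         = λ a → reachable a ∨ not (does (P? a))
    ; B         = λ a → not (reachable a)
    ; cover     = cover
    ; separates = separates
    }
    where
    cover : ∀ a → ((reachable a ∨ not (does (P? a))) ∨ not (reachable a)) ≡ true
    cover a with reachable a
    ... | true  = refl
    ... | false = Boolₚ.∨-zeroʳ (not (does (P? a)))
    separates : ∀ a b → Adj G a b → not (reachable a) ≡ false →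
                (reachable b ∨ not (does (P? b))) ≡ false → ⊥
    separates a b ab ra rb∨¬Pb with P? b
    ... | yes Pb = contradiction (reachable-closed (Boolₚ.not-injective ra) ab Pb)
                                 (Boolₚ.not-¬ (Boolₚ.∨-conicalˡ _ _ rb∨¬Pb))
    ... | no _   = contradiction (Boolₚ.∨-conicalʳ (reachable b) true rb∨¬Pb) λ ()

  both-separation⇒¬P : ∀ {a} → both separation a ≡ true → ¬ P a
  both-separation⇒¬P {a} a∈A∩B with reachable a | P? a
  ... | false | yes _  = contradiction a∈A∩B λ ()
  ... | false | no ¬Pa = ¬Pa

-- Balanced graphs

balanced⇒connected : ∀ G → OneMinorBalanced G → Connected G
balanced⇒connected G balanced u w _ _ with walk? G U? u w
... | yes uw = uw
... | no ¬uw = ⊥-elim (balanced-separation-not-disjoint balanced separation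
                         (1≤count {a = u} u∈A) (1≤count {a = w} w∈B) nothing-shared)
  where
  open Reachability G U? u
  u∈A : (reachable u ∨ false) ≡ true
  u∈A rewrite reachable-complete (stop tt) = refl
  w∈B : not (reachable w) ≡ true
  w∈B = cong not (dec-false (walk? G U? u w) ¬uw)
  nothing-shared : ∀ a → both separation a ≡ false
  nothing-shared a = Boolₚ.¬-not λ a∈A∩B → both-separation⇒¬P a∈A∩B tt

strictly-balanced⇒no-cut-vertex : ∀ G → StrictlyOneMinorBalanced G → ∀ x → ConnectedIn G (λ u → u ≢ x)
strictly-balanced⇒no-cut-vertex G strictly-balanced x u w u≢x w≢x with walk? G (∁? (Finₚ._≟ x)) u w
... | yes uw = uw
... | no ¬uw = ⊥-elim (strictly-balanced-separation-not-thin strictly-balanced separation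
                         (2≤count {a = u} {b = x} u∈A x∈A u≢x) (2≤count {a = w} {b = x} w∈B x∈B w≢x)
                         only-x-shared)
  where
  open Reachability G (∁? (Finₚ._≟ x)) u
  x-unreachable : reachable x ≡ false
  x-unreachable = Boolₚ.¬-not λ rx → reachable⇒P rx refl
  u∈A : (reachable u ∨ not (does (∁? (Finₚ._≟ x) u))) ≡ true
  u∈A rewrite reachable-complete (stop u≢x) = refl
  x∈A : (reachable x ∨ not (does (∁? (Finₚ._≟ x) x))) ≡ true
  x∈A rewrite x-unreachable | dec-true (x Finₚ.≟ x) refl = refl
  w∈B : not (reachable w) ≡ true
  w∈B = cong not (dec-false (walk? G (∁? (Finₚ._≟ x)) u w) ¬uw)
  x∈B : not (reachable x) ≡ true
  x∈B = cong not x-unreachable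
  only-x-shared : ∀ a b → both separation a ≡ true → both separation b ≡ true → a ≡ b
  only-x-shared a b a∈A∩B b∈A∩B =
    trans (decidable-stable (a Finₚ.≟ x) (both-separation⇒¬P a∈A∩B))
          (sym (decidable-stable (b Finₚ.≟ x) (both-separation⇒¬P b∈A∩B)))

connected-order-2⇒≅K₂ : ∀ G → V G ≡ 2 → Connected G → G ≅ K₂
connected-order-2⇒≅K₂ record { V = .2 ; adj = a ; adj-sym = a-sym ; adj-irrefl = a-irrefl } refl connected
  with connected zero (suc zero) tt tt
... | step {w = zero}     _ 0~0 _ = contradiction (trans (sym 0~0) (a-irrefl zero)) λ ()
... | step {w = suc zero} _ 0~1 _ = ↔-id _ , same-table
  where
  same-table : ∀ i j → a i j ≡ adj K₂ i j
  same-table zero       zero       = a-irrefl zero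
  same-table zero       (suc zero) = 0~1
  same-table (suc zero) zero       = trans (a-sym (suc zero) zero) 0~1
  same-table (suc zero) (suc zero) = a-irrefl (suc zero)

balanced⇒strictly-minor-balanced : ∀ G → OneMinorBalanced G → StrictlyMinorBalanced G
balanced⇒strictly-minor-balanced G (0<ρ , balanced) H (H≼G , H≇G) 1≤vH =
  *-<⇒dens-< H G 1≤vH 1≤vG (cross-≤⇒*-< 1≤vH 1≤vG cross eH<eG)
  where
  1≤vG : 1 ≤ V G
  1≤vG = ℕₚ.≤-trans (s≤s z≤n) (proj₂ (ρ₁-pos G 0<ρ))
  cross : e H * (V G ∸ 1) ≤ e G * (V H ∸ 1)
  cross = ρ₁-≤⇒*-≤ H G 0<ρ (balanced H H≼G)
  eH<eG : e H < e G
  eH<eG with ℕₚ.m≤n⇒m<n∨m≡n (≼⇒V≤ {H} {G} H≼G)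
  ... | inj₁ vH<vG = cross-≤⇒e-< (proj₁ (ρ₁-pos G 0<ρ)) 1≤vH vH<vG cross
  ... | inj₂ vH≡vG = ≺-same-order⇒e-< {H} {G} H≼G H≇G (ℕₚ.≤-reflexive (sym vH≡vG))

lemma5 : (G : Graph) → OneMinorBalanced G →
    Connected G
    × (StrictlyOneMinorBalanced G → (G ≅ K₂) ⊎ TwoConnected G)
    × StrictlyMinorBalanced G
lemma5 G balanced = connected , K₂⊎2-connected , balanced⇒strictly-minor-balanced G balanced
  where
  connected : Connected G
  connected = balanced⇒connected G balanced
  K₂⊎2-connected : StrictlyOneMinorBalanced G → (G ≅ K₂) ⊎ TwoConnected G
  K₂⊎2-connected strictly-balanced with V G ℕ.≟ 2
  ... | yes n≡2 = inj₁ (connected-order-2⇒≅K₂ G n≡2 connected)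
  ... | no  n≢2 = inj₂ ( ℕₚ.≤∧≢⇒< (proj₂ (ρ₁-pos G (proj₁ balanced))) (n≢2 ∘ sym)
                       , connected
                       , strictly-balanced⇒no-cut-vertex G strictly-balanced )
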